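{- There exist infinitely many finite simple graphs $G$ having no $\{P_{2},P_{5}\}$-factor such that $c_{1}(G-X)+\frac{2}{3}c_{3}(G-X)\leq \frac{4}{3}|X|+\frac{2}{3}$ for all $X\subseteq V(G)$.
   Context: For a graph $H$ and an integer $i\geq 1$, $c_{i}(H)$ denotes the number of connected components of $H$ having exactly $i$ vertices. $P_{n}$ denotes the path on $n$ vertices. A $\{P_{2},P_{5}\}$-factor of a graph is a spanning subgraph each of whose components is isomorphic to $P_{2}$ or $P_{5}$. -}

module Defs where

open import Data.Nat using (ℕ; zero; suc; _+_; _*_; _≤_)
open import Data.Bool using (Bool; true; false; _∧_; _∨_; not)
open import Data.Fin using (Fin; toℕ; _≟_; _<?_)
open import Data.Fin.Subset using (Subset)
open import Data.Vec using (lookup)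
open import Data.Product using (Σ; _×_; ∃; ∃-syntax)
open import Data.Sum using (_⊎_)
open import Relation.Binary.PropositionalEquality using (_≡_)
open import Relation.Nullary.Decidable using (⌊_⌋)
open import Function.Definitions using (Injective)

record Graph (n : ℕ) : Set where
  field
    adj    : Fin n → Fin n → Bool
    sym    : ∀ u v → adj u v ≡ adj v u
    irrefl : ∀ v → adj v v ≡ false
open Graph public

anyFin : ∀ {n} → (Fin n → Bool) → Bool
anyFin {zero}  f = false
anyFin {suc n} f = f Fin.zero ∨ anyFin (λ i → f (Fin.suc i))

countFin : ∀ {n} → (Fin n → Bool) → ℕ
countFin {zero}  f = 0
countFin {suc n} f = (if f Fin.zero then 1 else 0) + countFin (λ i → f (Fin.suc i))
  where open import Data.Bool using (if_then_else_)

module _ {n : ℕ} (G : Graph n) (X : Subset n) where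
  alive : Fin n → Bool
  alive v = not (lookup X v)

  reachK : ℕ → Fin n → Fin n → Bool
  reachK zero    u v = alive u ∧ alive v ∧ ⌊ u ≟ v ⌋
  reachK (suc k) u v = reachK k u v ∨ anyFin (λ w → reachK k u w ∧ adj G w v ∧ alive v)

  -- u and v lie in the same connected component of G - X
  -- (walks of length ≤ n suffice in a graph with n vertices)
  conn : Fin n → Fin n → Bool
  conn = reachK n

  compSize : Fin n → ℕ
  compSize u = countFin (conn u)

  isRep : Fin n → Bool
  isRep u = alive u ∧ not (anyFin (λ w → conn u w ∧ ⌊ w <? u ⌋))

  -- c i (G - X): number of connected components of G - X with exactly i vertices
  -- (each component counted once, via its least vertex)
  cMinus : ℕ → ℕ
  cMinus i = countFin (λ u → isRep u ∧ ⌊ compSize u Data.Nat.≟ i ⌋)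
    where import Data.Nat

pathAdj : ∀ {k} → Fin k → Fin k → Set
pathAdj i j = (suc (toℕ i) ≡ toℕ j) ⊎ (suc (toℕ j) ≡ toℕ i)

-- The component of F containing v is isomorphic to P_k:
-- an injective p : Fin k → Fin n whose image contains v, is closed under
-- F-neighbours (so the image is the whole component), and such that
-- F(p i)(p j) holds exactly when i, j are adjacent in P_k.
CompIsPath : ∀ {n} → (Fin n → Fin n → Bool) → Fin n → ℕ → Set
CompIsPath {n} F v k =
  Σ (Fin k → Fin n) λ p →
    Injective _≡_ _≡_ p
    × (∃[ i ] p i ≡ v)
    × (∀ i w → F (p i) w ≡ true → ∃[ j ] p j ≡ w)
    × (∀ i j → (F (p i) (p j) ≡ true → pathAdj i j) × (pathAdj i j → F (p i) (p j) ≡ true))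

HasP2P5Factor : ∀ {n} → Graph n → Set
HasP2P5Factor {n} G =
  Σ (Fin n → Fin n → Bool) λ F →
    (∀ u v → F u v ≡ F v u)
    × (∀ u v → F u v ≡ true → adj G u v ≡ true)
    × (∀ v → CompIsPath F v 2 ⊎ CompIsPath F v 5)

-- The witnesses are G = K₃ ⊎ Kₘ with m ≥ 4.  Any spanning subgraph F ⊆ G keeps the triangle
-- closed under F-edges; an F-component isomorphic to P₅ would need five distinct triangle
-- vertices, so all three triangle vertices lie on isolated F-edges, which would partition an odd
-- set into pairs.  For the inequality: if X = ∅, G − X has no
-- singleton and only one component of order 3 (Kₘ is too big), so the left side is 2; if X ≠ ∅,
-- G − X still has at most two components, so 3 c₁ + 2 c₃ ≤ 3 (c₁ + c₃) ≤ 6 ≤ 4 |X| + 2.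

module Submission where

open import Defs hiding (sym)
open import Data.Nat using (ℕ; _+_; _*_; _≤_)
open import Data.Product using (Σ; _×_)
open import Data.Fin.Subset using (Subset; ∣_∣)
open import Relation.Nullary using (¬_)

open import Data.Nat using (zero; suc; z≤n; s≤s; _<_; _≤′_; ≤′-refl; ≤′-step; _<ᵇ_)
import Data.Nat.Properties as ℕ
open import Data.Fin using (Fin; toℕ; inject₁; fromℕ<) renaming (zero to fzero; suc to fsuc)
import Data.Fin as Fin
import Data.Fin.Properties as Fin
open import Data.Bool using (Bool; true; false; not; _∧_; _∨_)
import Data.Bool as Bool
open import Data.Bool.Properties
  using (∧-conicalˡ; ∧-conicalʳ; ∧-zeroʳ; ∨-zeroʳ; ¬-not; not-injective; T-≡)
open import Data.Vec using (_∷_; []; lookup)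
open import Data.Product using (_,_; proj₁; proj₂; ∃-syntax)
open import Data.Sum using (_⊎_; inj₁; inj₂; [_,_]′; map₂; swap)
open import Data.Empty using (⊥; ⊥-elim)
open import Function using (_∘′_)
open import Function.Bundles using (Equivalence)
open import Function.Definitions using (Injective)
open import Relation.Binary.Definitions using (DecidableEquality; tri<; tri≈; tri>)
open import Relation.Binary.PropositionalEquality
open import Relation.Nullary using (Dec; yes; no; contradiction)
open import Relation.Nullary.Decidable using (⌊_⌋)

⌊⌋-true : ∀ {P : Set} (d : Dec P) → P → ⌊ d ⌋ ≡ true
⌊⌋-true (yes _) _ = refl
⌊⌋-true (no ¬p) p = contradiction p ¬p

⌊⌋-false : ∀ {P : Set} (d : Dec P) → ¬ P → ⌊ d ⌋ ≡ false
⌊⌋-false (yes p) ¬p = contradiction p ¬p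
⌊⌋-false (no _)  _  = refl

⌊⌋-sound : ∀ {P : Set} (d : Dec P) → ⌊ d ⌋ ≡ true → P
⌊⌋-sound (yes p) _ = p

⌊≟⌋-sym : ∀ {A : Set} (_≟_ : DecidableEquality A) x y → ⌊ x ≟ y ⌋ ≡ ⌊ y ≟ x ⌋
⌊≟⌋-sym _≟_ x y with x ≟ y
... | yes x≡y = sym (⌊⌋-true (y ≟ x) (sym x≡y))
... | no x≢y  = sym (⌊⌋-false (y ≟ x) (λ y≡x → x≢y (sym y≡x)))

anyFin-intro : ∀ {n} (f : Fin n → Bool) w → f w ≡ true → anyFin f ≡ true
anyFin-intro f fzero    fw rewrite fw = refl
anyFin-intro f (fsuc w) fw rewrite anyFin-intro (λ i → f (fsuc i)) w fw = ∨-zeroʳ (f fzero)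

countFin-false : ∀ {n} (f : Fin n → Bool) → (∀ u → f u ≡ false) → countFin f ≡ 0
countFin-false {zero}  f never = refl
countFin-false {suc n} f never rewrite never fzero =
  countFin-false (λ i → f (fsuc i)) (λ u → never (fsuc u))

countFin-const-true : ∀ n → countFin {n} (λ _ → true) ≡ n
countFin-const-true zero    = refl
countFin-const-true (suc n) = cong suc (countFin-const-true n)

countFin-mono : ∀ {n} {f g : Fin n → Bool} → (∀ u → f u ≡ true → g u ≡ true) → countFin f ≤ countFin g
countFin-mono {zero}          f⇒g = z≤n
countFin-mono {suc n} {f} {g} f⇒g with f fzero in f₀ | g fzero in g₀
... | false | false = countFin-mono (λ u → f⇒g (fsuc u))
... | false | true  = ℕ.m≤n⇒m≤1+n (countFin-mono (λ u → f⇒g (fsuc u)))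
... | true  | true  = s≤s (countFin-mono (λ u → f⇒g (fsuc u)))
... | true  | false = contradiction (trans (sym (f⇒g fzero f₀)) g₀) λ ()

countFin-≤1 : ∀ {n} (f : Fin n → Bool) →
              (∀ u w → f u ≡ true → f w ≡ true → u ≡ w) → countFin f ≤ 1
countFin-≤1 {zero}  f unique = z≤n
countFin-≤1 {suc n} f unique with f fzero in f₀
... | true  = ℕ.≤-reflexive (cong suc (countFin-false (λ i → f (fsuc i))
                (λ u → ¬-not (λ fu → Fin.0≢1+n (unique _ _ f₀ fu)))))
... | false = countFin-≤1 (λ i → f (fsuc i)) (λ u w fu fw → Fin.suc-injective (unique _ _ fu fw))

countFin-split : ∀ {n} (f c : Fin n → Bool) →
  countFin f ≡ countFin (λ u → f u ∧ c u) + countFin (λ u → f u ∧ not (c u))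
countFin-split {zero}  f c = refl
countFin-split {suc n} f c with f fzero | c fzero | countFin-split (λ i → f (fsuc i)) (λ i → c (fsuc i))
... | false | _     | ih = ih
... | true  | true  | ih = cong suc ih
... | true  | false | ih = trans (cong suc ih) (sym (ℕ.+-suc (countFin (λ u → f (fsuc u) ∧ c (fsuc u))) _))

module _ {n} (G : Graph n) (X : Subset n) where

  reachK-mono : ∀ {k l u v} → k ≤′ l → reachK G X k u v ≡ true → reachK G X l u v ≡ true
  reachK-mono ≤′-refl        r = r
  reachK-mono (≤′-step k≤l) r rewrite reachK-mono k≤l r = refl

  private
    reachK-0-refl : ∀ {u} → alive G X u ≡ true → reachK G X 0 u u ≡ true
    reachK-0-refl {u} alive-u rewrite alive-u = ⌊⌋-true (u Fin.≟ u) refl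

  conn-refl : ∀ {u} → alive G X u ≡ true → conn G X u u ≡ true
  conn-refl alive-u = reachK-mono {l = n} (ℕ.≤⇒≤′ z≤n) (reachK-0-refl alive-u)

  adj⇒conn : ∀ {u v} → alive G X u ≡ true → alive G X v ≡ true → adj G u v ≡ true → conn G X u v ≡ true
  adj⇒conn {u} {v} alive-u alive-v uv =
    reachK-mono {l = n} (ℕ.≤⇒≤′ (ℕ.≤-trans (s≤s z≤n) (Fin.toℕ<n u))) reach₁
    where
    step : reachK G X 0 u u ∧ adj G u v ∧ alive G X v ≡ true
    step rewrite reachK-0-refl alive-u | uv | alive-v = refl
    reach₁ : reachK G X 1 u v ≡ true
    reach₁ = subst (λ b → reachK G X 0 u v ∨ b ≡ true) (sym (anyFin-intro _ u step)) (∨-zeroʳ _)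

  isRep⇒alive : ∀ {u} → isRep G X u ≡ true → alive G X u ≡ true
  isRep⇒alive = ∧-conicalˡ _ _

  isRep-least : ∀ {u w} → isRep G X u ≡ true → conn G X u w ≡ true → ¬ w Fin.< u
  isRep-least {u} {w} rep uw w<u =
    contradiction (subst (λ b → not b ≡ true) (anyFin-intro _ w earlier) (∧-conicalʳ _ _ rep)) λ ()
    where
    earlier : conn G X u w ∧ ⌊ w Fin.<? u ⌋ ≡ true
    earlier rewrite uw = ⌊⌋-true (w Fin.<? u) w<u

  isRep-unique : ∀ {u w} → isRep G X u ≡ true → isRep G X w ≡ true →
                 conn G X u w ≡ true → conn G X w u ≡ true → u ≡ w
  isRep-unique {u} {w} rep-u rep-w uw wu with Fin.<-cmp u w
  ... | tri< u<w _ _ = ⊥-elim (isRep-least rep-w wu u<w)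
  ... | tri≈ _ u≡w _ = u≡w
  ... | tri> _ _ w<u = ⊥-elim (isRep-least rep-u uw w<u)

  cMinus-+-≤-components : ∀ {i j} → i ≢ j → cMinus G X i + cMinus G X j ≤ countFin (isRep G X)
  cMinus-+-≤-components {i} {j} i≢j = begin
    cMinus G X i + cMinus G X j
      ≤⟨ ℕ.+-monoʳ-≤ (cMinus G X i) (countFin-mono size-j⇒size-not-i) ⟩
    countFin (λ u → isRep G X u ∧ hasSize i u) + countFin (λ u → isRep G X u ∧ not (hasSize i u))
      ≡⟨ sym (countFin-split (isRep G X) (hasSize i)) ⟩
    countFin (isRep G X) ∎
    where
    open ℕ.≤-Reasoning
    hasSize : ℕ → Fin n → Bool
    hasSize s u = ⌊ compSize G X u ℕ.≟ s ⌋
    size-j⇒size-not-i : ∀ u → isRep G X u ∧ hasSize j u ≡ true → isRep G X u ∧ not (hasSize i u) ≡ true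
    size-j⇒size-not-i u h = cong₂ (λ a b → a ∧ not b) (∧-conicalˡ _ _ h)
      (⌊⌋-false (compSize G X u ℕ.≟ i)
        (λ size≡i → i≢j (trans (sym size≡i) (⌊⌋-sound (compSize G X u ℕ.≟ j) (∧-conicalʳ _ _ h)))))

  ≤2-components⇒bound : countFin (isRep G X) ≤ 2 → 1 ≤ ∣ X ∣ →
                        3 * cMinus G X 1 + 2 * cMinus G X 3 ≤ 4 * ∣ X ∣ + 2
  ≤2-components⇒bound ≤2 1≤∣X∣ = begin
    3 * c₁ + 2 * c₃  ≤⟨ ℕ.+-monoʳ-≤ (3 * c₁) (ℕ.*-monoˡ-≤ c₃ (ℕ.n≤1+n 2)) ⟩
    3 * c₁ + 3 * c₃  ≡⟨ ℕ.*-distribˡ-+ 3 c₁ c₃ ⟨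
    3 * (c₁ + c₃)    ≤⟨ ℕ.*-monoʳ-≤ 3 (ℕ.≤-trans (cMinus-+-≤-components λ ()) ≤2) ⟩
    4 * 1 + 2        ≤⟨ ℕ.+-monoˡ-≤ 2 (ℕ.*-monoʳ-≤ 4 1≤∣X∣) ⟩
    4 * ∣ X ∣ + 2    ∎
    where
    open ℕ.≤-Reasoning
    c₁ c₃ : ℕ
    c₁ = cMinus G X 1
    c₃ = cMinus G X 3

twoCliques : ∀ {n} → (Fin n → Bool) → Graph n
twoCliques c = record
  { adj    = λ u v → ⌊ c u Bool.≟ c v ⌋ ∧ not ⌊ u Fin.≟ v ⌋
  ; sym    = λ u v → cong₂ (λ a b → a ∧ not b) (⌊≟⌋-sym Bool._≟_ (c u) (c v)) (⌊≟⌋-sym Fin._≟_ u v)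
  ; irrefl = λ v → cong₂ (λ a b → a ∧ not b) (⌊⌋-true (c v Bool.≟ c v) refl) (⌊⌋-true (v Fin.≟ v) refl)
  }

twoCliques-adj⇒sameColour : ∀ {n} (c : Fin n → Bool) {u v} → adj (twoCliques c) u v ≡ true → c u ≡ c v
twoCliques-adj⇒sameColour c {u} {v} uv = ⌊⌋-sound (c u Bool.≟ c v) (∧-conicalˡ _ _ uv)

module _ {n} (c : Fin n → Bool) (X : Subset n) where

  sameColour⇒conn : ∀ {u v} → alive (twoCliques c) X u ≡ true → alive (twoCliques c) X v ≡ true →
                    c u ≡ c v → conn (twoCliques c) X u v ≡ true
  sameColour⇒conn {u} {v} alive-u alive-v cu≡cv with u Fin.≟ v
  ... | yes refl = conn-refl (twoCliques c) X alive-u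
  ... | no u≢v   = adj⇒conn (twoCliques c) X alive-u alive-v
                     (cong₂ (λ a b → a ∧ not b) (⌊⌋-true (c u Bool.≟ c v) cu≡cv) (⌊⌋-false (u Fin.≟ v) u≢v))

  isRep-sameColour-≤1 : (g : Fin n → Bool) → (∀ u w → g u ≡ true → g w ≡ true → c u ≡ c w) →
                        countFin (λ u → isRep (twoCliques c) X u ∧ g u) ≤ 1
  isRep-sameColour-≤1 g same = countFin-≤1 _ λ u w ru rw →
    let rep-u   = ∧-conicalˡ _ _ ru
        rep-w   = ∧-conicalˡ _ _ rw
        alive-u = isRep⇒alive (twoCliques c) X rep-u
        alive-w = isRep⇒alive (twoCliques c) X rep-w
        cu≡cw   = same u w (∧-conicalʳ _ _ ru) (∧-conicalʳ _ _ rw)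
    in isRep-unique (twoCliques c) X rep-u rep-w
         (sameColour⇒conn alive-u alive-w cu≡cw) (sameColour⇒conn alive-w alive-u (sym cu≡cw))

  twoCliques-components-≤2 : countFin (isRep (twoCliques c) X) ≤ 2
  twoCliques-components-≤2 = begin
    countFin (isRep (twoCliques c) X)
      ≡⟨ countFin-split (isRep (twoCliques c) X) c ⟩
    countFin (λ u → isRep (twoCliques c) X u ∧ c u) + countFin (λ u → isRep (twoCliques c) X u ∧ not (c u))
      ≤⟨ ℕ.+-mono-≤ (isRep-sameColour-≤1 c (λ _ _ cu cw → trans cu (sym cw)))
                    (isRep-sameColour-≤1 (λ u → not (c u)) (λ _ _ cu cw → not-injective (trans cu (sym cw)))) ⟩
    2 ∎
    where open ℕ.≤-Reasoning

  colourClass-≤-compSize : (∀ v → alive (twoCliques c) X v ≡ true) →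
                           ∀ u → countFin (λ v → ⌊ c u Bool.≟ c v ⌋) ≤ compSize (twoCliques c) X u
  colourClass-≤-compSize all-alive u =
    countFin-mono λ v same → sameColour⇒conn (all-alive u) (all-alive v) (⌊⌋-sound (c u Bool.≟ c v) same)

IsolatedEdge : ∀ {n} → (Fin n → Fin n → Bool) → Fin n → Fin n → Set
IsolatedEdge F u v =
  u ≢ v × F u v ≡ true
  × (∀ w → F u w ≡ true → w ≡ u ⊎ w ≡ v) × (∀ w → F v w ≡ true → w ≡ u ⊎ w ≡ v)

isolatedEdge-sym : ∀ {n} {F : Fin n → Fin n → Bool} → (∀ u v → F u v ≡ F v u) →
                   ∀ {u v} → IsolatedEdge F u v → IsolatedEdge F v u
isolatedEdge-sym F-sym {u} {v} (u≢v , uv , nbr-u , nbr-v) =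
  (λ v≡u → u≢v (sym v≡u)) , trans (F-sym v u) uv , (λ w → swap ∘′ nbr-v w) , (λ w → swap ∘′ nbr-u w)

P₂⇒isolatedEdge : ∀ {n} {F : Fin n → Fin n → Bool} → (∀ u v → F u v ≡ F v u) →
                  ∀ {v} → CompIsPath F v 2 → ∃[ x ] IsolatedEdge F v x
P₂⇒isolatedEdge {F = F} F-sym (p , p-inj , (i , refl) , closed , edges) = partner i
  where
  image : ∀ w → ∃[ j ] p j ≡ w → w ≡ p fzero ⊎ w ≡ p (fsuc fzero)
  image w (fzero      , refl) = inj₁ refl
  image w (fsuc fzero , refl) = inj₂ refl
  edge : IsolatedEdge F (p fzero) (p (fsuc fzero))
  edge = (λ eq → Fin.0≢1+n (p-inj eq)) , proj₂ (edges fzero (fsuc fzero)) (inj₁ refl)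
       , (λ w e → image w (closed fzero w e)) , (λ w e → image w (closed (fsuc fzero) w e))
  partner : ∀ i → ∃[ x ] IsolatedEdge F (p i) x
  partner fzero        = _ , edge
  partner (fsuc fzero) = _ , isolatedEdge-sym F-sym edge

isolatedEdge-no-third : ∀ {n} {F : Fin n → Fin n → Bool} → (∀ u v → F u v ≡ F v u) →
  ∀ {a x y z} → IsolatedEdge F a x → IsolatedEdge F y z → y ≢ a → y ≢ x → ¬ (z ≡ a ⊎ z ≡ x ⊎ z ≡ y)
isolatedEdge-no-third F-sym (_ , _ , nbr-a , _) (_ , yz , _ , _) y≢a y≢x (inj₁ refl) =
  [ y≢a , y≢x ]′ (nbr-a _ (trans (F-sym _ _) yz))
isolatedEdge-no-third F-sym (_ , _ , _ , nbr-x) (_ , yz , _ , _) y≢a y≢x (inj₂ (inj₁ refl)) =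
  [ y≢a , y≢x ]′ (nbr-x _ (trans (F-sym _ _) yz))
isolatedEdge-no-third F-sym _ (y≢z , _) _ _ (inj₂ (inj₂ refl)) = y≢z refl

chain-constant : ∀ {A : Set} {k} (f : Fin (suc k) → A) →
                 (∀ i → f (inject₁ i) ≡ f (fsuc i)) → ∀ j → f j ≡ f fzero
chain-constant             f step fzero    = refl
chain-constant {k = suc k} f step (fsuc j) =
  trans (chain-constant (λ i → f (fsuc i)) (λ i → step (fsuc i)) j) (sym (step fzero))

path-monochromatic : ∀ {A : Set} {n k} {F : Fin n → Fin n → Bool} (c : Fin n → A) →
  (∀ u w → F u w ≡ true → c u ≡ c w) → ∀ {v} (P : CompIsPath F v (suc k)) → ∀ j → c (proj₁ P j) ≡ c v
path-monochromatic c F⇒same (p , _ , (i , refl) , _ , edges) j = trans (along j) (sym (along i))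
  where
  along : ∀ j → c (p j) ≡ c (p fzero)
  along = chain-constant (λ j → c (p j))
    λ i → F⇒same _ _ (proj₂ (edges (inject₁ i) (fsuc i)) (inj₁ (cong suc (Fin.toℕ-inject₁ i))))

-- On Fin (3 + m) the vertices 0, 1, 2 form the triangle, so twoCliques inTriangle is K₃ ⊎ Kₘ.
inTriangle : ∀ {n} → Fin n → Bool
inTriangle v = toℕ v <ᵇ 3

inTriangle⇒<3 : ∀ {n} {v : Fin n} → inTriangle v ≡ true → toℕ v < 3
inTriangle⇒<3 {v = v} e = ℕ.<ᵇ⇒< (toℕ v) 3 (Equivalence.from T-≡ e)

triangle-vertices : ∀ {m} (v : Fin (3 + m)) → inTriangle v ≡ true →
                    v ≡ fzero ⊎ v ≡ fsuc fzero ⊎ v ≡ fsuc (fsuc fzero)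
triangle-vertices fzero               _ = inj₁ refl
triangle-vertices (fsuc fzero)        _ = inj₂ (inj₁ refl)
triangle-vertices (fsuc (fsuc fzero)) _ = inj₂ (inj₂ refl)

triangle-pigeonhole : ∀ {n k} (p : Fin k → Fin n) → 3 < k → Injective _≡_ _≡_ p →
                      (∀ j → inTriangle (p j) ≡ true) → ⊥
triangle-pigeonhole p 3<k p-inj inside with Fin.pigeonhole 3<k (λ j → fromℕ< (inTriangle⇒<3 (inside j)))
... | i , j , i<j , same = Fin.<-irrefl (p-inj (Fin.toℕ-injective (begin
  toℕ (p i)                               ≡⟨ Fin.toℕ-fromℕ< (inTriangle⇒<3 (inside i)) ⟨
  toℕ (fromℕ< (inTriangle⇒<3 (inside i))) ≡⟨ cong toℕ same ⟩
  toℕ (fromℕ< (inTriangle⇒<3 (inside j))) ≡⟨ Fin.toℕ-fromℕ< (inTriangle⇒<3 (inside j)) ⟩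
  toℕ (p j)                               ∎))) i<j
  where open ≡-Reasoning

triangle+clique-noFactor : ∀ m → ¬ HasP2P5Factor (twoCliques {3 + m} inTriangle)
triangle+clique-noFactor m (F , F-sym , F⊆G , components) = matching-of-triangle
  where
  F-sameSide : ∀ u w → F u w ≡ true → inTriangle u ≡ inTriangle w
  F-sameSide u w uw = twoCliques-adj⇒sameColour inTriangle {u} {w} (F⊆G u w uw)

  partner : ∀ v → inTriangle v ≡ true → ∃[ x ] IsolatedEdge F v x
  partner v inside = [ P₂⇒isolatedEdge F-sym , (λ P₅ → ⊥-elim (noP₅ P₅)) ]′ (components v)
    where
    noP₅ : CompIsPath F v 5 → ⊥
    noP₅ P₅ = triangle-pigeonhole (proj₁ P₅) (s≤s (s≤s (s≤s (s≤s z≤n)))) (proj₁ (proj₂ P₅))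
                λ j → trans (path-monochromatic inTriangle F-sameSide P₅ j) inside

  partner-inside : ∀ {v x} → inTriangle v ≡ true → IsolatedEdge F v x → inTriangle x ≡ true
  partner-inside inside (_ , vx , _) = trans (sym (F-sameSide _ _ vx)) inside

  third-unmatched : ∀ {x} y → IsolatedEdge F fzero x → y ≢ fzero → y ≢ x → inTriangle y ≡ true →
                    (∀ {z} → inTriangle z ≡ true → z ≡ fzero ⊎ z ≡ x ⊎ z ≡ y) → ⊥
  third-unmatched y edge y≢0 y≢x inside triangle =
    isolatedEdge-no-third F-sym edge edge′ y≢0 y≢x (triangle (partner-inside inside edge′))
    where
    edge′ : IsolatedEdge F y (proj₁ (partner y inside))
    edge′ = proj₂ (partner y inside)

  zero-unmatched : ∀ {x} → IsolatedEdge F fzero x →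
                   x ≡ fzero ⊎ x ≡ fsuc fzero ⊎ x ≡ fsuc (fsuc fzero) → ⊥
  zero-unmatched edge (inj₁ refl)        = proj₁ edge refl
  zero-unmatched edge (inj₂ (inj₁ refl)) = third-unmatched (fsuc (fsuc fzero)) edge (λ ()) (λ ()) refl
                                             (triangle-vertices _)
  zero-unmatched edge (inj₂ (inj₂ refl)) = third-unmatched (fsuc fzero) edge (λ ()) (λ ()) refl
                                             (λ inside → map₂ swap (triangle-vertices _ inside))

  matching-of-triangle : ⊥
  matching-of-triangle = zero-unmatched edge (triangle-vertices _ (partner-inside refl edge))
    where
    edge : IsolatedEdge F fzero (proj₁ (partner fzero refl))
    edge = proj₂ (partner fzero refl)

module _ {m} (4≤m : 4 ≤ m) (X : Subset (3 + m))
         (all-alive : ∀ v → alive (twoCliques inTriangle) X v ≡ true) where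

  private
    colourClass : Bool → ℕ
    colourClass b = countFin (λ (v : Fin (3 + m)) → ⌊ b Bool.≟ inTriangle v ⌋)

    colourClass-≤-compSizeOf : ∀ {b} u → inTriangle u ≡ b → colourClass b ≤ compSize (twoCliques inTriangle) X u
    colourClass-≤-compSizeOf u side =
      subst (λ b → colourClass b ≤ compSize (twoCliques inTriangle) X u) side
        (colourClass-≤-compSize inTriangle X all-alive u)

  -- colourClass true computes to 1 + 1 + 1 + _, and colourClass false to countFin (λ _ → true).
  compSize-triangle : ∀ u → inTriangle u ≡ true → 3 ≤ compSize (twoCliques inTriangle) X u
  compSize-triangle u inside = ℕ.≤-trans (ℕ.m≤m+n 3 _) (colourClass-≤-compSizeOf u inside)

  compSize-clique : ∀ u → inTriangle u ≡ false → m ≤ compSize (twoCliques inTriangle) X u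
  compSize-clique u outside =
    ℕ.≤-trans (ℕ.≤-reflexive (sym (countFin-const-true m))) (colourClass-≤-compSizeOf u outside)

  compSize-≥3 : ∀ u → 3 ≤ compSize (twoCliques inTriangle) X u
  compSize-≥3 u = bySide (inTriangle u) refl
    where
    bySide : ∀ b → inTriangle u ≡ b → 3 ≤ compSize (twoCliques inTriangle) X u
    bySide true  side = compSize-triangle u side
    bySide false side = ℕ.≤-trans (ℕ.n≤1+n 3) (ℕ.≤-trans 4≤m (compSize-clique u side))

  compSize≡3⇒inTriangle : ∀ u → compSize (twoCliques inTriangle) X u ≡ 3 → inTriangle u ≡ true
  compSize≡3⇒inTriangle u size≡3 = bySide (inTriangle u) refl
    where
    bySide : ∀ b → inTriangle u ≡ b → inTriangle u ≡ true
    bySide true  side = side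
    bySide false side = ⊥-elim (ℕ.<⇒≢ (ℕ.≤-trans 4≤m (compSize-clique u side)) (sym size≡3))

  no-singletons : cMinus (twoCliques inTriangle) X 1 ≡ 0
  no-singletons = countFin-false _ λ u →
    trans (cong (isRep (twoCliques inTriangle) X u ∧_)
                (⌊⌋-false (compSize (twoCliques inTriangle) X u ℕ.≟ 1)
                  λ size≡1 → ℕ.<⇒≢ (ℕ.≤-trans (ℕ.n≤1+n 2) (compSize-≥3 u)) (sym size≡1)))
          (∧-zeroʳ (isRep (twoCliques inTriangle) X u))

  at-most-one-triangle : cMinus (twoCliques inTriangle) X 3 ≤ 1
  at-most-one-triangle = ℕ.≤-trans (countFin-mono size3⇒inTriangle)
    (isRep-sameColour-≤1 inTriangle X inTriangle (λ _ _ inside-u inside-w → trans inside-u (sym inside-w)))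
    where
    size3⇒inTriangle : ∀ u → isRep (twoCliques inTriangle) X u ∧ ⌊ compSize (twoCliques inTriangle) X u ℕ.≟ 3 ⌋
                             ≡ true →
                           isRep (twoCliques inTriangle) X u ∧ inTriangle u ≡ true
    size3⇒inTriangle u h = cong₂ _∧_ (∧-conicalˡ _ _ h)
      (compSize≡3⇒inTriangle u (⌊⌋-sound (compSize (twoCliques inTriangle) X u ℕ.≟ 3) (∧-conicalʳ _ _ h)))

  triangle+clique-bound-empty : 3 * cMinus (twoCliques inTriangle) X 1 + 2 * cMinus (twoCliques inTriangle) X 3
                              ≤ 4 * ∣ X ∣ + 2
  triangle+clique-bound-empty = begin
    3 * c₁ + 2 * c₃  ≡⟨ cong (λ k → 3 * k + 2 * c₃) no-singletons ⟩
    2 * c₃           ≤⟨ ℕ.*-monoʳ-≤ 2 at-most-one-triangle ⟩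
    2                ≤⟨ ℕ.m≤n+m 2 (4 * ∣ X ∣) ⟩
    4 * ∣ X ∣ + 2    ∎
    where
    open ℕ.≤-Reasoning
    c₁ c₃ : ℕ
    c₁ = cMinus (twoCliques inTriangle) X 1
    c₃ = cMinus (twoCliques inTriangle) X 3

allOutside⊎1≤∣_∣ : ∀ {n} (X : Subset n) → (∀ v → lookup X v ≡ false) ⊎ 1 ≤ ∣ X ∣
allOutside⊎1≤∣ [] ∣        = inj₁ λ ()
allOutside⊎1≤∣ true ∷ X ∣  = inj₂ (s≤s z≤n)
allOutside⊎1≤∣ false ∷ X ∣ with allOutside⊎1≤∣ X ∣
... | inj₁ outside = inj₁ λ { fzero → refl ; (fsuc v) → outside v }
... | inj₂ 1≤∣X∣   = inj₂ 1≤∣X∣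

triangle+clique-bound : ∀ {m} → 4 ≤ m → (X : Subset (3 + m)) →
  3 * cMinus (twoCliques inTriangle) X 1 + 2 * cMinus (twoCliques inTriangle) X 3 ≤ 4 * ∣ X ∣ + 2
triangle+clique-bound 4≤m X =
  [ (λ outside → triangle+clique-bound-empty 4≤m X (λ v → cong not (outside v)))
  , ≤2-components⇒bound (twoCliques inTriangle) X (twoCliques-components-≤2 inTriangle X)
  ]′ (allOutside⊎1≤∣ X ∣)

proposition2 : (N : ℕ) → Σ ℕ λ n → N ≤ n × Σ (Graph n) λ G →
    ¬ HasP2P5Factor G
    × ((X : Subset n) → 3 * cMinus G X 1 + 2 * cMinus G X 3 ≤ 4 * ∣ X ∣ + 2)
proposition2 N =
  3 + m , ℕ.m≤n+m N 7 , twoCliques inTriangle ,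
  triangle+clique-noFactor m , triangle+clique-bound {m} (ℕ.m≤m+n 4 N)
  where
  m : ℕ
  m = 4 + N
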